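{- Let $G$ be a binary quasigroup of order $n$. If a tuple $V\in\mathcal I_n^n$ belongs to a unit $\mathcal Y$ of some equivalence class, then for every $\pi\in S_n$ the tuple $V^\pi$ also belongs to $\mathcal Y$.
   Context: Let $\mathcal I_n=\{1,\dots,n\}$. A binary quasigroup $G$ of order $n$ is the set $\mathcal I_n$ with an operation $*$ such that for all $a_0,a_1,a_2$ there are unique $x_1,x_2$ with $a_1*x_2=a_0$ and $x_1*a_2=a_0$. Elements of $\mathcal I_n^n$ are tuples; $*$ acts on tuples entrywise. For $V=(v_1,\dots,v_n)$ and $\pi\in S_n$, $V^\pi=(v_{\pi(1)},\dots,v_{\pi(n)})$. A permutation is a tuple with pairwise distinct entries; $\mathcal W$ is the set of permutations. For $d\ge0$, a $U$-diagonal of type $V$ in $G[d]$ is a sequence $(W_1,\dots,W_d)\in\mathcal W^d$ with $(\cdots((U*W_1)*W_2)*\cdots)*W_d=V$ entrywise. Tuples $U,V$ are equivalent if for some $d\ge0$ there is a $U$-diagonal of type $V$ in $G[d]$; the classes are the equivalence classes. The period $\tau$ of a class $\mathcal U$ is the gcd of all $d\ge1$ such that some $U\in\mathcal U$ admits a $U$-diagonal of type $U$ in $G[d]$. A class of period $\tau$ is partitioned into $\tau$ sets $\mathcal Y_1,\dots,\mathcal Y_\tau$, called units, such that for $U\in\mathcal Y_k$, $V\in\mathcal Y_l$ a $U$-diagonal of type $V$ in $G[d]$ exists only if $l-k\equiv d\pmod\tau$. -}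

module Defs where

open import Data.Nat using (ℕ; zero; suc; _≥_)
open import Data.Fin using (Fin)
open import Data.Vec using (Vec; []; _∷_; zipWith; lookup; tabulate)
open import Data.Product using (Σ; ∃; ∃!; _×_; _,_)
open import Data.Integer using (ℤ; +_; _-_; _+_)
open import Data.Integer.Divisibility using (_∣_)
open import Data.Fin.Permutation using (Permutation′; _⟨$⟩ʳ_)
open import Function.Definitions using (Injective)
open import Relation.Binary.PropositionalEquality using (_≡_)

IsQuasigroup : (n : ℕ) → (Fin n → Fin n → Fin n) → Set
IsQuasigroup n _*_ =
  (∀ a₀ a₁ → ∃! _≡_ (λ x₂ → a₁ * x₂ ≡ a₀)) ×
  (∀ a₀ a₂ → ∃! _≡_ (λ x₁ → x₁ * a₂ ≡ a₀))

Tuple : ℕ → Set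
Tuple n = Vec (Fin n) n

module _ {n : ℕ} (_*_ : Fin n → Fin n → Fin n) where

  _⊛_ : Tuple n → Tuple n → Tuple n
  U ⊛ W = zipWith _*_ U W

  -- a permutation is a tuple with pairwise distinct entries
  IsPermTuple : Tuple n → Set
  IsPermTuple W = Injective _≡_ _≡_ (lookup W)

  PermTuple : Set
  PermTuple = Σ (Tuple n) IsPermTuple

  applyAll : {d : ℕ} → Tuple n → Vec PermTuple d → Tuple n
  applyAll U [] = U
  applyAll U ((W , _) ∷ Ws) = applyAll (U ⊛ W) Ws

  HasDiagonal : Tuple n → Tuple n → ℕ → Set
  HasDiagonal U V d = Σ (Vec PermTuple d) (λ Ws → applyAll U Ws ≡ V)

  Equivalent : Tuple n → Tuple n → Set
  Equivalent U V = ∃ λ d → HasDiagonal U V d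

  -- τ is the period of the class of U₀: τ is the gcd of all d ≥ 1 such that
  -- some U in the class has a U-diagonal of type U in G[d]
  -- (gcd characterised as the greatest common divisor w.r.t. divisibility).
  IsPeriod : Tuple n → ℕ → Set
  IsPeriod U₀ τ =
    (∀ U d → Equivalent U₀ U → d ≥ 1 → HasDiagonal U U d → τ Data.Nat.Divisibility.∣ d) ×
    (∀ m → (∀ U d → Equivalent U₀ U → d ≥ 1 → HasDiagonal U U d → m Data.Nat.Divisibility.∣ d)
         → m Data.Nat.Divisibility.∣ τ)
    where import Data.Nat.Divisibility

  -- A partition of the class of U₀ into τ units Y_k = { U in class | unit U ≡ k },
  -- with the defining property: U ∈ Y_k, V ∈ Y_l and a U-diagonal of type V in G[d]
  -- exists only if l - k ≡ d (mod τ).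
  IsUnitPartition : Tuple n → (τ : ℕ) → (Tuple n → Fin τ) → Set
  IsUnitPartition U₀ τ unit =
    ∀ U V d → Equivalent U₀ U → Equivalent U₀ V → HasDiagonal U V d →
      (+ τ) ∣ ((+ Data.Fin.toℕ (unit V) - + Data.Fin.toℕ (unit U)) - + d)
    where import Data.Fin

permuteTuple : {n : ℕ} → Tuple n → Permutation′ n → Tuple n
permuteTuple V π = tabulate (λ i → lookup V (π ⟨$⟩ʳ i))

-- Every permutation is a product of transpositions, so it suffices to treat
-- V^t for t = (p q) with V_p ≠ V_q.  Pick y with V_q * y = V_p * p; then the
-- permutation tuples A = (q y) and B = (q y) ∘ t satisfy V * A = V^t * B =: Z,
-- because i ↦ V_i * A_i takes equal values at p and q.  Right multiplication
-- by B is injective on the finitely many tuples, hence of finite order, so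
-- further steps by B lead from Z back to V^t, which is thus in the class.
-- Both V and V^t reach Z in one step, so their units are both one below
-- that of Z and coincide.
module Submission where

open import Defs
open import Data.Nat using (ℕ; zero; suc; _+_; _<_)
open import Data.Nat.GeneralisedArithmetic using (iterate)
import Data.Nat.Properties as ℕ
import Data.Nat.Divisibility as ℕ
open import Data.Fin using (Fin; toℕ; funToFin; finToFun)
open import Data.Fin.Properties using (_≟_; pigeonhole; toℕ-injective; toℕ<n; finToFun-funToFin)
open import Data.Fin.Permutation using (Permutation′; _⟨$⟩ʳ_; _∘ₚ_; _⟨$⟩ˡ_; _≈_; id; transpose; inverseˡ)
import Data.Fin.Permutation.Components as PC
open import Data.Fin.Permutation.Transposition.List using (TranspositionList; eval; decompose; eval-decompose)
open import Data.Integer using (ℤ; +_; _-_; ∣_∣)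
import Data.Integer.Properties as ℤ
open import Data.Integer.Divisibility.Signed using (_∣_; ∣m∣n⇒∣m-n; ∣ᵤ⇒∣; ∣⇒∣ᵤ)
open import Data.Integer.Tactic.RingSolver using (solve-∀)
open import Data.List using ([]; _∷_)
open import Data.Vec using (Vec; []; _∷_; _++_; lookup; tabulate; replicate)
open import Data.Vec.Properties using (lookup-zipWith; lookup∘tabulate; tabulate∘lookup)
open import Data.Vec.Relation.Binary.Pointwise.Extensional using (ext; Pointwise-≡⇒≡)
open import Data.Product using (∃; ∃₂; _×_; _,_; proj₁; proj₂)
open import Function.Base using (_∘_)
open import Function.Definitions using (Injective)
open import Relation.Binary.PropositionalEquality
open import Relation.Nullary using (yes; no; contradiction)

module _ {a} {A : Set a} (f : A → A) where

  iterate-+ : ∀ x m n → iterate f x (m + n) ≡ iterate f (iterate f x m) n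
  iterate-+ x zero    n = refl
  iterate-+ x (suc m) n = iterate-+ (f x) m n

  iterate-injective : Injective _≡_ _≡_ f → ∀ m → Injective _≡_ _≡_ (λ x → iterate f x m)
  iterate-injective f-inj zero    eq = eq
  iterate-injective f-inj (suc m) eq = f-inj (iterate-injective f-inj m eq)

  -- Pigeonhole on the first k + 1 points of the orbit, then cancel the
  -- common prefix of the two colliding iterates.
  iterate-recurrent : ∀ {k} {encode : A → Fin k} → Injective _≡_ _≡_ encode →
                      Injective _≡_ _≡_ f → ∀ x → ∃ λ c → iterate f x (suc c) ≡ x
  iterate-recurrent {k} {encode} encode-inj f-inj x
    with i , j , i<j , collision ← pigeonhole (ℕ.n<1+n k) (λ t → encode (iterate f x (toℕ t)))
    with c , i+1+c≡j ← ℕ.m≤n⇒∃[o]m+o≡n i<j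
    = c , iterate-injective f-inj (toℕ i) (begin
      iterate f (iterate f x (suc c)) (toℕ i) ≡⟨ iterate-+ x (suc c) (toℕ i) ⟨
      iterate f x (suc c + toℕ i)             ≡⟨ cong (iterate f x ∘ suc) (ℕ.+-comm c (toℕ i)) ⟩
      iterate f x (suc (toℕ i) + c)           ≡⟨ cong (iterate f x) i+1+c≡j ⟩
      iterate f x (toℕ j)                     ≡⟨ encode-inj collision ⟨
      iterate f x (toℕ i)                     ∎)
    where open ≡-Reasoning

vec-ext : ∀ {a} {A : Set a} {n} {xs ys : Vec A n} → (∀ i → lookup xs i ≡ lookup ys i) → xs ≡ ys
vec-ext eq = Pointwise-≡⇒≡ (ext eq)

funToFin∘lookup-injective : ∀ {m n} → Injective _≡_ _≡_ (λ (xs : Vec (Fin m) n) → funToFin (lookup xs))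
funToFin∘lookup-injective {x = xs} {ys} eq = vec-ext λ i →
  trans (sym (finToFun-funToFin (lookup xs) i))
        (trans (cong (λ t → finToFun t i) eq) (finToFun-funToFin (lookup ys) i))

∣-cancel-common : ∀ {k} c a b d → k ∣ (c - a) - d → k ∣ (c - b) - d → k ∣ a - b
∣-cancel-common {k} c a b d k∣cad k∣cbd =
  subst (k ∣_) (difference c a b d) (∣m∣n⇒∣m-n k∣cbd k∣cad)
  where
  difference : ∀ c a b d → ((c - b) - d) - ((c - a) - d) ≡ a - b
  difference = solve-∀

toℕ-injective-mod : ∀ {τ} (a b : Fin τ) → + τ ∣ + toℕ a - + toℕ b → a ≡ b
toℕ-injective-mod {τ} a b τ∣a-b = toℕ-injective (ℤ.+-injective (ℤ.i-j≡0⇒i≡j _ _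
  (ℤ.∣i∣≡0⇒i≡0 (small-multiple-is-zero ∣a-b∣<τ (∣⇒∣ᵤ τ∣a-b)))))
  where
  small-multiple-is-zero : ∀ {m} → m < τ → τ ℕ.∣ m → m ≡ 0
  small-multiple-is-zero {zero}  _   _   = refl
  small-multiple-is-zero {suc m} m<τ τ∣m = contradiction τ∣m (ℕ.>⇒∤ m<τ)
  ∣a-b∣<τ : ∣ + toℕ a - + toℕ b ∣ < τ
  ∣a-b∣<τ = subst (_< τ) (cong ∣_∣ (sym (ℤ.[+m]-[+n]≡m⊖n (toℕ a) (toℕ b))))
    (ℕ.≤-<-trans (ℤ.∣m⊝n∣≤m⊔n (toℕ a) (toℕ b))
                 (ℕ.⊔-lub (toℕ<n a) (toℕ<n b)))

transpose-respects : ∀ {a} {A : Set a} {n} (g : Fin n → A) {p q : Fin n} →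
                     g p ≡ g q → ∀ i → g (PC.transpose p q i) ≡ g i
transpose-respects g {p} {q} gp≡gq i with i ≟ p
... | yes refl = sym gp≡gq
... | no _ with i ≟ q
...   | yes refl = gp≡gq
...   | no _ = refl

transpose-matchˡ : ∀ {n} (p q : Fin n) → PC.transpose p q p ≡ q
transpose-matchˡ p q with p ≟ p
... | yes _   = refl
... | no p≢p = contradiction refl p≢p

transpose-fix : ∀ {n} {p q i : Fin n} → i ≢ p → i ≢ q → PC.transpose p q i ≡ i
transpose-fix {p = p} {q} {i} i≢p i≢q with i ≟ p
... | yes i≡p = contradiction i≡p i≢p
... | no _ with i ≟ q
...   | yes i≡q = contradiction i≡q i≢q
...   | no _ = refl

lookup-permuteTuple : ∀ {n} (V : Tuple n) π i → lookup (permuteTuple V π) i ≡ lookup V (π ⟨$⟩ʳ i)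
lookup-permuteTuple V π = lookup∘tabulate (λ i → lookup V (π ⟨$⟩ʳ i))

permuteTuple-id : ∀ {n} (V : Tuple n) → permuteTuple V id ≡ V
permuteTuple-id = tabulate∘lookup

permuteTuple-∘ₚ : ∀ {n} (V : Tuple n) σ ρ →
                  permuteTuple V (σ ∘ₚ ρ) ≡ permuteTuple (permuteTuple V ρ) σ
permuteTuple-∘ₚ V σ ρ = vec-ext λ i → begin
  lookup (permuteTuple V (σ ∘ₚ ρ)) i       ≡⟨ lookup-permuteTuple V (σ ∘ₚ ρ) i ⟩
  lookup V (ρ ⟨$⟩ʳ (σ ⟨$⟩ʳ i))             ≡⟨ lookup-permuteTuple V ρ (σ ⟨$⟩ʳ i) ⟨
  lookup (permuteTuple V ρ) (σ ⟨$⟩ʳ i)     ≡⟨ lookup-permuteTuple (permuteTuple V ρ) σ i ⟨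
  lookup (permuteTuple (permuteTuple V ρ) σ) i ∎
  where open ≡-Reasoning

permuteTuple-cong : ∀ {n} (V : Tuple n) {σ ρ} → σ ≈ ρ → permuteTuple V σ ≡ permuteTuple V ρ
permuteTuple-cong V {σ} {ρ} σ≈ρ = vec-ext λ i →
  trans (lookup-permuteTuple V σ i)
        (trans (cong (lookup V) (σ≈ρ i)) (sym (lookup-permuteTuple V ρ i)))

module Quasigroup {n : ℕ} (_*_ : Fin n → Fin n → Fin n) (quasigroup : IsQuasigroup n _*_) where

  *-cancelʳ : ∀ {x y w} → x * w ≡ y * w → x ≡ y
  *-cancelʳ {y = y} {w} eq with proj₂ quasigroup (y * w) w
  ... | _ , _ , unique = trans (sym (unique eq)) (unique refl)

  leftDivide : ∀ a b → ∃ λ x → a * x ≡ b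
  leftDivide a b with proj₁ quasigroup b a
  ... | x , ax≡b , _ = x , ax≡b

  infixl 6 _⊙_
  _⊙_ : Tuple n → Tuple n → Tuple n
  _⊙_ = _⊛_ _*_

  lookup-⊙ : ∀ U W i → lookup (U ⊙ W) i ≡ lookup U i * lookup W i
  lookup-⊙ U W i = lookup-zipWith _*_ i U W

  ⊙-cancelʳ : ∀ B → Injective _≡_ _≡_ (_⊙ B)
  ⊙-cancelʳ B {U} {U′} eq = vec-ext λ i → *-cancelʳ (begin
    lookup U i * lookup B i  ≡⟨ lookup-⊙ U B i ⟨
    lookup (U ⊙ B) i         ≡⟨ cong (λ X → lookup X i) eq ⟩
    lookup (U′ ⊙ B) i        ≡⟨ lookup-⊙ U′ B i ⟩
    lookup U′ i * lookup B i ∎)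
    where open ≡-Reasoning

  toPermTuple : Permutation′ n → PermTuple _*_
  toPermTuple σ = tabulate (σ ⟨$⟩ʳ_) , λ {i} {j} eq → begin
    i                                ≡⟨ inverseˡ σ ⟨
    σ ⟨$⟩ˡ (σ ⟨$⟩ʳ i)                ≡⟨ cong (σ ⟨$⟩ˡ_) (lookup∘tabulate (σ ⟨$⟩ʳ_) i) ⟨
    σ ⟨$⟩ˡ lookup (tabulate (σ ⟨$⟩ʳ_)) i ≡⟨ cong (σ ⟨$⟩ˡ_) eq ⟩
    σ ⟨$⟩ˡ lookup (tabulate (σ ⟨$⟩ʳ_)) j ≡⟨ cong (σ ⟨$⟩ˡ_) (lookup∘tabulate (σ ⟨$⟩ʳ_) j) ⟩
    σ ⟨$⟩ˡ (σ ⟨$⟩ʳ j)                ≡⟨ inverseˡ σ ⟩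
    j                                ∎
    where open ≡-Reasoning

  applyAll-++ : ∀ {d e} U (Ws : Vec (PermTuple _*_) d) (Ws′ : Vec (PermTuple _*_) e) →
                applyAll _*_ U (Ws ++ Ws′) ≡ applyAll _*_ (applyAll _*_ U Ws) Ws′
  applyAll-++ U []            Ws′ = refl
  applyAll-++ U ((W , _) ∷ Ws) Ws′ = applyAll-++ (U ⊙ W) Ws Ws′

  applyAll-replicate : ∀ U (B : PermTuple _*_) m →
                       applyAll _*_ U (replicate m B) ≡ iterate (_⊙ proj₁ B) U m
  applyAll-replicate U B zero    = refl
  applyAll-replicate U B (suc m) = applyAll-replicate (U ⊙ proj₁ B) B m

  equivalent-trans : ∀ {U V W} → Equivalent _*_ U V → Equivalent _*_ V W → Equivalent _*_ U W
  equivalent-trans {U} (d , Ws , U→V) (e , Ws′ , V→W) =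
    d + e , Ws ++ Ws′ , trans (applyAll-++ U Ws Ws′) (trans (cong (λ X → applyAll _*_ X Ws′) U→V) V→W)

  ⊙-recurrent : ∀ B Y → ∃ λ c → iterate (_⊙ B) Y (suc c) ≡ Y
  ⊙-recurrent B = iterate-recurrent (_⊙ B) funToFin∘lookup-injective (⊙-cancelʳ B)

  equivalent-⊙⁻¹ : ∀ Y (B : PermTuple _*_) → Equivalent _*_ (Y ⊙ proj₁ B) Y
  equivalent-⊙⁻¹ Y B with c , Y-returns ← ⊙-recurrent (proj₁ B) Y =
    c , replicate c B , trans (applyAll-replicate (Y ⊙ proj₁ B) B c) Y-returns

  Joinable : Tuple n → Tuple n → Set
  Joinable V W = ∃₂ λ (A B : PermTuple _*_) → V ⊙ proj₁ A ≡ W ⊙ proj₁ B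

  joinable-transpose : ∀ V p q → Joinable V (permuteTuple V (transpose p q))
  joinable-transpose V p q with lookup V p ≟ lookup V q
  ... | yes Vp≡Vq = I , I , cong (_⊙ proj₁ I) (sym V^t≡V)
    where
    I : PermTuple _*_
    I = toPermTuple id
    V^t≡V : permuteTuple V (transpose p q) ≡ V
    V^t≡V = vec-ext λ i →
      trans (lookup-permuteTuple V (transpose p q) i) (transpose-respects (lookup V) Vp≡Vq i)
  ... | no Vp≢Vq = toPermTuple α , toPermTuple (t ∘ₚ α) , vec-ext λ i → begin
    lookup (V ⊙ A) i                            ≡⟨ lookup-⊙ V A i ⟩
    lookup V i * lookup A i                     ≡⟨ cong (lookup V i *_) (lookup∘tabulate (α ⟨$⟩ʳ_) i) ⟩
    g i                                         ≡⟨ transpose-respects g gp≡gq i ⟨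
    g (t ⟨$⟩ʳ i)                                ≡⟨ cong₂ _*_ (lookup-permuteTuple V t i)
                                                     (lookup∘tabulate ((t ∘ₚ α) ⟨$⟩ʳ_) i) ⟨
    lookup (permuteTuple V t) i * lookup B i    ≡⟨ lookup-⊙ (permuteTuple V t) B i ⟨
    lookup (permuteTuple V t ⊙ B) i             ∎
    where
    open ≡-Reasoning
    t : Permutation′ n
    t = transpose p q
    y : Fin n
    y = proj₁ (leftDivide (lookup V q) (lookup V p * p))
    Vq*y≡Vp*p : lookup V q * y ≡ lookup V p * p
    Vq*y≡Vp*p = proj₂ (leftDivide (lookup V q) (lookup V p * p))
    α : Permutation′ n
    α = transpose q y
    A B : Tuple n
    A = proj₁ (toPermTuple α)
    B = proj₁ (toPermTuple (t ∘ₚ α))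
    g : Fin n → Fin n
    g i = lookup V i * (α ⟨$⟩ʳ i)
    p≢q : p ≢ q
    p≢q refl = Vp≢Vq refl
    p≢y : p ≢ y
    p≢y p≡y = Vp≢Vq (sym (*-cancelʳ (trans (cong (lookup V q *_) p≡y) Vq*y≡Vp*p)))
    gp≡gq : g p ≡ g q
    gp≡gq = begin
      lookup V p * (α ⟨$⟩ʳ p) ≡⟨ cong (lookup V p *_) (transpose-fix p≢q p≢y) ⟩
      lookup V p * p          ≡⟨ Vq*y≡Vp*p ⟨
      lookup V q * y          ≡⟨ cong (lookup V q *_) (transpose-matchˡ q y) ⟨
      lookup V q * (α ⟨$⟩ʳ q) ∎

module Units {n : ℕ} (_*_ : Fin n → Fin n → Fin n) (quasigroup : IsQuasigroup n _*_)
             (U₀ : Tuple n) (τ : ℕ) (unit : Tuple n → Fin τ)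
             (units : IsUnitPartition _*_ U₀ τ unit) where

  open Quasigroup _*_ quasigroup

  SameUnit : Tuple n → Tuple n → Set
  SameUnit V W = Equivalent _*_ U₀ W × unit W ≡ unit V

  sameUnit-trans : ∀ {U V W} → SameUnit U V → SameUnit V W → SameUnit U W
  sameUnit-trans (_ , unit-V≡unit-U) (W∈ , unit-W≡unit-V) = W∈ , trans unit-W≡unit-V unit-V≡unit-U

  joinable⇒sameUnit : ∀ {V W} → Equivalent _*_ U₀ V → Joinable V W → SameUnit V W
  joinable⇒sameUnit {V} {W} V∈ (A , B , VA≡WB) =
    W∈ , toℕ-injective-mod (unit W) (unit V)
           (∣-cancel-common (rank Z) (rank W) (rank V) (+ 1)
             (∣ᵤ⇒∣ (units W Z 1 W∈ Z∈ W→Z)) (∣ᵤ⇒∣ (units V Z 1 V∈ Z∈ V→Z)))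
    where
    rank : Tuple n → ℤ
    rank X = + toℕ (unit X)
    Z : Tuple n
    Z = V ⊙ proj₁ A
    V→Z : HasDiagonal _*_ V Z 1
    V→Z = A ∷ [] , refl
    W→Z : HasDiagonal _*_ W Z 1
    W→Z = B ∷ [] , sym VA≡WB
    Z∈ : Equivalent _*_ U₀ Z
    Z∈ = equivalent-trans V∈ (1 , V→Z)
    W∈ : Equivalent _*_ U₀ W
    W∈ = equivalent-trans Z∈ (subst (λ X → Equivalent _*_ X W) (sym VA≡WB) (equivalent-⊙⁻¹ W B))

  sameUnit-eval : ∀ (xs : TranspositionList n) {V} → Equivalent _*_ U₀ V →
                  SameUnit V (permuteTuple V (eval xs))
  sameUnit-eval []             {V} V∈ = subst (SameUnit V) (sym (permuteTuple-id V)) (V∈ , refl)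
  sameUnit-eval ((p , q) ∷ xs) {V} V∈ =
    subst (SameUnit V) (sym (permuteTuple-∘ₚ V (transpose p q) (eval xs)))
      (sameUnit-trans V~W (joinable⇒sameUnit (proj₁ V~W) (joinable-transpose W p q)))
    where
    W : Tuple n
    W = permuteTuple V (eval xs)
    V~W : SameUnit V W
    V~W = sameUnit-eval xs V∈

proposition4 : (n : ℕ) (_*_ : Fin n → Fin n → Fin n) → IsQuasigroup n _*_ →
    (U₀ : Tuple n) (τ : ℕ) → IsPeriod _*_ U₀ τ →
    (unit : Tuple n → Fin τ) → IsUnitPartition _*_ U₀ τ unit →
    (V : Tuple n) → Equivalent _*_ U₀ V →
    (π : Permutation′ n) →
    Equivalent _*_ U₀ (permuteTuple V π) × unit (permuteTuple V π) ≡ unit V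
proposition4 n _*_ quasigroup U₀ τ _ unit units V V∈ π =
  subst (SameUnit V) (permuteTuple-cong V {eval (decompose π)} {π} (eval-decompose π))
        (sameUnit-eval (decompose π) V∈)
  where open Units _*_ quasigroup U₀ τ unit units
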